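{- For all positive integers $d$, $k$, and $l$ with $k>l$, there exists a divisor $c$ of $d$ such that \[ \alpha(\mathbb{Z}_d,\{k,l\}) \;\le\; \gamma(\mathbb{Z}_c,\{k,l\})\cdot\frac{d}{c}. \]
   Context: For a subset $A$ of $\mathbb{Z}_d$ and a positive integer $h$, $hA$ denotes the $h$-fold sumset $\{a_1+\cdots+a_h : a_i\in A\}$. For positive integers $k>l$, $A$ is $(k,l)$-sum-free if $kA\cap lA=\emptyset$. An arithmetic progression in $\mathbb{Z}_d$ is a set $\{a+i\cdot b : i=0,1,\dots,m-1\}$ with $m$ a positive integer, $a,b\in\mathbb{Z}_d$ and $m\le d/\gcd(d,b)$ (so it has exactly $m$ elements); when $m=1$ one takes $b=1$. $\alpha(\mathbb{Z}_d,\{k,l\})$ is the maximum size of a $(k,l)$-sum-free arithmetic progression in $\mathbb{Z}_d$, and $\gamma(\mathbb{Z}_c,\{k,l\})$ is the maximum size of a $(k,l)$-sum-free arithmetic progression in $\mathbb{Z}_c$ whose common difference $b$ satisfies $\gcd(b,c)=1$ (each taken to be $0$ if there is none). -}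

module Defs where

open import Data.Nat using (ℕ; zero; suc; _+_; _*_; _≤_; _<_)
open import Data.Nat.GCD using (gcd)
open import Data.List using (List; length)
open import Data.Nat.ListAction using (sum)
open import Data.List.Relation.Unary.All using (All)
open import Data.Product using (Σ; _×_; ∃)
open import Data.Sum using (_⊎_)
open import Relation.Binary.PropositionalEquality using (_≡_)
open import Relation.Nullary using (¬_)

-- Elements of ℤ_d are represented by natural numbers; equality in ℤ_d is
-- congruence modulo d:  x ≡ y (mod d)  iff  x + p*d = y + q*d for some p q.
CongMod : ℕ → ℕ → ℕ → Set
CongMod d x y = Σ ℕ λ p → Σ ℕ λ q → x + p * d ≡ y + q * d

InAP : ℕ → ℕ → ℕ → ℕ → ℕ → Set
InAP d a b m x = Σ ℕ λ i → i < m × CongMod d x (a + i * b)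

-- Admissible parameters of an arithmetic progression with exactly m elements:
-- 1 ≤ m ≤ d / gcd(d,b)  (written m * gcd(d,b) ≤ d, as gcd(d,b) ∣ d),
-- and when m = 1 the difference is b = 1 (in ℤ_d).
ValidAP : ℕ → ℕ → ℕ → ℕ → Set
ValidAP d a b m = 1 ≤ m × m * gcd d b ≤ d × (m ≡ 1 → CongMod d b 1)

InSumset : ℕ → (ℕ → Set) → ℕ → ℕ → Set
InSumset d A h x = Σ (List ℕ) λ xs → length xs ≡ h × All A xs × CongMod d x (sum xs)

SumFree : ℕ → (ℕ → Set) → ℕ → ℕ → Set
SumFree d A k l = ¬ (Σ ℕ λ x → InSumset d A k x × InSumset d A l x)

SumFreeAPOfSize : ℕ → ℕ → ℕ → ℕ → Set
SumFreeAPOfSize d k l m =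
  Σ ℕ λ a → Σ ℕ λ b → ValidAP d a b m × SumFree d (InAP d a b m) k l

CoprimeSumFreeAPOfSize : ℕ → ℕ → ℕ → ℕ → Set
CoprimeSumFreeAPOfSize c k l m =
  Σ ℕ λ a → Σ ℕ λ b → ValidAP c a b m × gcd b c ≡ 1 × SumFree c (InAP c a b m) k l

IsMaxSize : (ℕ → Set) → ℕ → Set
IsMaxSize P n = (P n ⊎ (n ≡ 0 × ∀ m → ¬ P m)) × (∀ m → P m → m ≤ n)

IsAlpha : ℕ → ℕ → ℕ → ℕ → Set
IsAlpha d k l n = IsMaxSize (SumFreeAPOfSize d k l) n

IsGamma : ℕ → ℕ → ℕ → ℕ → Set
IsGamma c k l n = IsMaxSize (CoprimeSumFreeAPOfSize c k l) n

-- Let A = {a + i b : i < m} be (k,l)-sum-free in ℤ_d and K = k − l. The elements of hA are the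
-- classes h a + s b with s ≤ h (m − 1), so A is sum-free iff no K a + s b ≡ t b (mod d) with
-- s ≤ k (m − 1), t ≤ l (m − 1). Write g = gcd(d,b), d = c g and b = b′ g; then b′ is a unit mod c.
-- If g ∤ K a, the one-point progression {1} ⊆ ℤ_g is sum-free (as g ∤ K), and m ≤ c = d / g.
-- If K a = u g, the condition reads u + s b′ ≢ t b′ (mod c). When h = gcd(K,c) divides u, some a′
-- solves K a′ ≡ u (mod c), and {a′ + i b′} ⊆ ℤ_c is sum-free of size m with unit difference.
-- Otherwise {1} ⊆ ℤ_(hg) is sum-free, and m ≤ c / h: else c ≤ (m − 1) K, and as the multiples of
-- the unit b′ exhaust ℤ_c, some u + s b′ ≡ t b′ would occur.

module Submission where

open import Defs
open import Data.Nat using (ℕ; zero; suc; pred; _+_; _*_; _∸_; _⊓_; _≤_; _<_; z≤n; s≤s; s≤s⁻¹; _≤?_; _≟_;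
  _%_; _/_; NonZero; ≢-nonZero; ≢-nonZero⁻¹; >-nonZero; >-nonZero⁻¹)
open import Data.Nat.Properties
open import Data.Nat.DivMod using (m≡m%n+[m/n]*n; [m+kn]%n≡m%n; m%n<n)
open import Data.Nat.Divisibility
open import Data.Nat.GCD
open import Data.List using ([]; _∷_; length)
open import Data.Nat.ListAction using (sum)
open import Data.List.Relation.Unary.All using (All; []; _∷_)
open import Data.Product using (Σ; _×_; _,_; proj₁; proj₂)
open import Data.Sum using (inj₁; inj₂)
open import Function using (_∘_)
open import Level using (0ℓ)
open import Relation.Nullary using (¬_; Dec; yes; no; contradiction)
open import Relation.Nullary.Decidable using (map′; _×-dec_; _→-dec_; ¬?)
open import Relation.Binary.Bundles using (Setoid)
open import Relation.Binary.PropositionalEquality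
import Relation.Binary.Reasoning.Setoid
open import Data.Nat.Tactic.RingSolver using (solve-∀)

-- Congruence modulo d

module _ {d : ℕ} where

  mod-reflexive : ∀ {x y} → x ≡ y → CongMod d x y
  mod-reflexive refl = 0 , 0 , refl

  mod-refl : ∀ {x} → CongMod d x x
  mod-refl = mod-reflexive refl

  mod-sym : ∀ {x y} → CongMod d x y → CongMod d y x
  mod-sym (p , q , e) = q , p , sym e

  mod-trans : ∀ {x y z} → CongMod d x y → CongMod d y z → CongMod d x z
  mod-trans {x} {y} {z} (p , q , x≡y) (p′ , q′ , y≡z) = p + p′ , q′ + q , (begin
    x + (p + p′) * d      ≡⟨ shift x p p′ d ⟩
    x + p * d + p′ * d    ≡⟨ cong (_+ p′ * d) x≡y ⟩
    y + q * d + p′ * d    ≡⟨ swap y q p′ d ⟩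
    y + p′ * d + q * d    ≡⟨ cong (_+ q * d) y≡z ⟩
    z + q′ * d + q * d    ≡⟨ shift z q′ q d ⟨
    z + (q′ + q) * d      ∎)
    where
    open ≡-Reasoning
    shift : ∀ x p p′ d → x + (p + p′) * d ≡ x + p * d + p′ * d
    shift = solve-∀
    swap : ∀ y q p′ d → y + q * d + p′ * d ≡ y + p′ * d + q * d
    swap = solve-∀

  mod-+ : ∀ {x y x′ y′} → CongMod d x y → CongMod d x′ y′ → CongMod d (x + x′) (y + y′)
  mod-+ {x} {y} {x′} {y′} (p , q , e) (p′ , q′ , e′) =
    p + p′ , q + q′ , trans (regroup x x′ p p′ d) (trans (cong₂ _+_ e e′) (sym (regroup y y′ q q′ d)))
    where
    regroup : ∀ x x′ p p′ d → x + x′ + (p + p′) * d ≡ (x + p * d) + (x′ + p′ * d)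
    regroup = solve-∀

  mod-*ˡ : ∀ n {x y} → CongMod d x y → CongMod d (n * x) (n * y)
  mod-*ˡ n {x} {y} (p , q , e) =
    n * p , n * q , trans (factor n x p d) (trans (cong (n *_) e) (sym (factor n y q d)))
    where
    factor : ∀ n x p d → n * x + n * p * d ≡ n * (x + p * d)
    factor = solve-∀

  mod-*ʳ : ∀ n {x y} → CongMod d x y → CongMod d (x * n) (y * n)
  mod-*ʳ n {x} {y} rewrite *-comm x n | *-comm y n = mod-*ˡ n

  mod-+-cancelˡ : ∀ z {x y} → CongMod d (z + x) (z + y) → CongMod d x y
  mod-+-cancelˡ z {x} {y} (p , q , e) =
    p , q , +-cancelˡ-≡ z _ _ (trans (sym (+-assoc z x (p * d))) (trans e (+-assoc z y (q * d))))

  mod-multiple : ∀ n → CongMod d (n * d) 0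
  mod-multiple n = 0 , n , +-identityʳ _

  mod-∣ : ∀ {e x y} → e ∣ d → e ∣ x → CongMod d x y → e ∣ y
  mod-∣ {e} {x} {y} e∣d e∣x (p , q , x≡y) =
    ∣m+n∣m⇒∣n (subst (e ∣_) (trans x≡y (+-comm y (q * d))) (∣m∣n⇒∣m+n e∣x (∣n⇒∣m*n p e∣d)))
              (∣n⇒∣m*n q e∣d)

  mod-0⇒∣ : ∀ {x} → CongMod d x 0 → d ∣ x
  mod-0⇒∣ x≡0 = mod-∣ ∣-refl (d ∣0) (mod-sym x≡0)

  gcd-mod : ∀ {b b′} → CongMod d b b′ → gcd d b ≡ gcd d b′
  gcd-mod {b} b≡b′ = gcd-universality
    (λ (e∣d , e∣b′) → gcd-greatest e∣d (mod-∣ e∣d e∣b′ (mod-sym b≡b′)))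
    (λ e∣g → let e∣d = ∣-trans e∣g (gcd[m,n]∣m _ _) in
             e∣d , mod-∣ e∣d (∣-trans e∣g (gcd[m,n]∣n d b)) b≡b′)

module _ {d : ℕ} .{{_ : NonZero d}} where

  mod-% : ∀ x → CongMod d x (x % d)
  mod-% x = 0 , x / d , trans (+-identityʳ x) (m≡m%n+[m/n]*n x d)

  mod⇒%≡ : ∀ {x y} → CongMod d x y → x % d ≡ y % d
  mod⇒%≡ {x} {y} (p , q , e) =
    trans (sym ([m+kn]%n≡m%n x p d)) (trans (cong (_% d) e) ([m+kn]%n≡m%n y q d))

  mod? : ∀ x y → Dec (CongMod d x y)
  mod? x y = map′ (λ e → mod-trans (mod-% x) (mod-trans (mod-reflexive e) (mod-sym (mod-% y))))
                  mod⇒%≡ (x % d ≟ y % d)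

mod-scale : ∀ g {c x y} → CongMod c x y → CongMod (g * c) (g * x) (g * y)
mod-scale g {c} {x} {y} (p , q , e) =
  p , q , trans (factor g x p c) (trans (cong (g *_) e) (sym (factor g y q c)))
  where
  factor : ∀ g x p c → g * x + p * (g * c) ≡ g * (x + p * c)
  factor = solve-∀

modSetoid : ℕ → Setoid 0ℓ 0ℓ
modSetoid d = record
  { Carrier = ℕ
  ; _≈_ = CongMod d
  ; isEquivalence = record { refl = mod-refl ; sym = mod-sym ; trans = mod-trans }
  }

module ModReasoning (d : ℕ) = Relation.Binary.Reasoning.Setoid (modSetoid d)

-- Sumsets of arithmetic progressions

Collision : ℕ → ℕ → ℕ → ℕ → ℕ → ℕ → Set
Collision d a b m k l =
  Σ ℕ λ s → s ≤ k * (pred m) × Σ ℕ λ t → t ≤ l * (pred m) × CongMod d (k * a + s * b) (l * a + t * b)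

module _ {d a b : ℕ} where

  sum-AP : ∀ {m xs} → All (InAP d a b m) xs →
           Σ ℕ λ s → s ≤ length xs * (pred m) × CongMod d (sum xs) (length xs * a + s * b)
  sum-AP [] = 0 , z≤n , mod-refl
  sum-AP {xs = _ ∷ xs} ((i , i<m , x≡) ∷ xs∈) with s , s≤ , sum≡ ← sum-AP xs∈ =
    i + s , +-mono-≤ (<⇒≤pred i<m) s≤ ,
    mod-trans (mod-+ x≡ sum≡) (mod-reflexive (regroup a b i s (length xs)))
    where
    regroup : ∀ a b i s n → a + i * b + (n * a + s * b) ≡ a + n * a + (i + s) * b
    regroup = solve-∀

  sumset-AP⁻ : ∀ {m h x} → InSumset d (InAP d a b m) h x →
               Σ ℕ λ s → s ≤ h * (pred m) × CongMod d x (h * a + s * b)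
  sumset-AP⁻ (xs , refl , xs∈ , x≡) with s , s≤ , sum≡ ← sum-AP xs∈ = s , s≤ , mod-trans x≡ sum≡

  sumset-AP⁺ : ∀ {m′} h s → s ≤ h * m′ → InSumset d (InAP d a b (suc m′)) h (h * a + s * b)
  sumset-AP⁺ zero s s≤0 rewrite n≤0⇒n≡0 s≤0 = [] , refl , [] , mod-refl
  sumset-AP⁺ {m′} (suc h) s s≤
    with xs , refl , xs∈ , rest≡ ←
           sumset-AP⁺ h (s ∸ m′) (subst (s ∸ m′ ≤_) (m+n∸m≡n m′ (h * m′)) (∸-monoˡ-≤ m′ s≤))
    = (a + i * b) ∷ xs , refl , (i , s≤s (m⊓n≤m m′ s) , mod-refl) ∷ xs∈ ,
      mod-trans (mod-reflexive split) (mod-+ (mod-refl {x = a + i * b}) rest≡)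
    where
    i = m′ ⊓ s
    split : suc h * a + s * b ≡ a + i * b + (h * a + (s ∸ m′) * b)
    split = trans (cong (λ s → suc h * a + s * b) (sym (m⊓n+n∸m≡n m′ s))) (regroup a b i (s ∸ m′) h)
      where
      regroup : ∀ a b i r h → suc h * a + (i + r) * b ≡ a + i * b + (h * a + r * b)
      regroup = solve-∀

module _ {d a b k l : ℕ} where

  inSumset-mod : ∀ {A h x y} → CongMod d x y → InSumset d A h y → InSumset d A h x
  inSumset-mod x≡y (xs , len , xs∈ , y≡) = xs , len , xs∈ , mod-trans x≡y y≡

  sumFree⇒¬collision : ∀ {m′} → SumFree d (InAP d a b (suc m′)) k l → ¬ Collision d a b (suc m′) k l
  sumFree⇒¬collision sf (s , s≤ , t , t≤ , coll) =
    sf (k * a + s * b , sumset-AP⁺ k s s≤ , inSumset-mod coll (sumset-AP⁺ l t t≤))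

  ¬collision⇒sumFree : ∀ {m} → ¬ Collision d a b m k l → SumFree d (InAP d a b m) k l
  ¬collision⇒sumFree no-coll (x , x∈kA , x∈lA)
    with s , s≤ , x≡ ← sumset-AP⁻ x∈kA | t , t≤ , x≡′ ← sumset-AP⁻ x∈lA =
    no-coll (s , s≤ , t , t≤ , mod-trans (mod-sym x≡) x≡′)

validSumFree⇒¬collision : ∀ {d a b m k l} → ValidAP d a b m → SumFree d (InAP d a b m) k l →
                          ¬ Collision d a b m k l
validSumFree⇒¬collision (s≤s z≤n , _) = sumFree⇒¬collision

collision-mod : ∀ {d a a′ b b′ m k l} → CongMod d a a′ → CongMod d b b′ →
                Collision d a b m k l → Collision d a′ b′ m k l
collision-mod {d} {a} {a′} {b} {b′} {k = k} {l} a≡ b≡ (s , s≤ , t , t≤ , coll) =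
  s , s≤ , t , t≤ , mod-trans (mod-sym (shift k s)) (mod-trans coll (shift l t))
  where
  shift : ∀ h r → CongMod d (h * a + r * b) (h * a′ + r * b′)
  shift h r = mod-+ (mod-*ˡ h a≡) (mod-*ˡ r b≡)

∃≤? : ∀ B {P : ℕ → Set} → (∀ n → Dec (P n)) → Dec (Σ ℕ λ n → n ≤ B × P n)
∃≤? B P? = map′ (λ (n , n<1+B , p) → n , s≤s⁻¹ n<1+B , p) (λ (n , n≤B , p) → n , s≤s n≤B , p)
                (anyUpTo? P? (suc B))

collision? : ∀ {d} .{{_ : NonZero d}} a b m k l → Dec (Collision d a b m k l)
collision? a b m k l =
  ∃≤? (k * pred m) λ s → ∃≤? (l * pred m) λ t → mod? (k * a + s * b) (l * a + t * b)

-- The maxima α and γ exist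

gcd-nonZeroˡ : ∀ m n .{{_ : NonZero m}} → NonZero (gcd m n)
gcd-nonZeroˡ m n = ≢-nonZero (gcd[m,n]≢0 m n (inj₁ (≢-nonZero⁻¹ m)))

-- ValidAP does not mention the start a of the progression, so lemmas about it need a explicitly.
module _ {d : ℕ} .{{_ : NonZero d}} where

  validAP? : ∀ a b m → Dec (ValidAP d a b m)
  validAP? a b m = (1 ≤? m) ×-dec (m * gcd d b ≤? d) ×-dec ((m ≟ 1) →-dec mod? b 1)

  validAP⇒≤ : ∀ {a b m} → ValidAP d a b m → m ≤ d
  validAP⇒≤ {b = b} {m} (_ , m*g≤d , _) = ≤-trans (m≤m*n m (gcd d b)) m*g≤d
    where instance _ = gcd-nonZeroˡ d b

  validSumFreeAP? : ∀ a b m k l → Dec (ValidAP d a b m × SumFree d (InAP d a b m) k l)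
  validSumFreeAP? a b m k l with validAP? a b m
  ... | no ¬valid = no (¬valid ∘ proj₁)
  ... | yes valid = map′ (λ no-collision → valid , ¬collision⇒sumFree no-collision)
                         (λ (_ , sumFree) → validSumFree⇒¬collision valid sumFree)
                         (¬? (collision? a b m k l))

  ∃-residues? : {Q : ℕ → ℕ → Set} →
    (∀ {a a′ b b′} → CongMod d a a′ → CongMod d b b′ → Q a b → Q a′ b′) → (∀ a b → Dec (Q a b)) →
    Dec (Σ ℕ λ a → Σ ℕ λ b → Q a b)
  ∃-residues? Q-mod Q? =
    map′ (λ (a , _ , b , _ , q) → a , b , q)
         (λ (a , b , q) → a % d , m%n<n a d , b % d , m%n<n b d , Q-mod (mod-% a) (mod-% b) q)
         (anyUpTo? (λ a → anyUpTo? (λ b → Q? a b) d) d)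

validAP-mod : ∀ {d a a′ b b′ m} → CongMod d b b′ → ValidAP d a b m → ValidAP d a′ b′ m
validAP-mod {d} {m = m} b≡b′ (1≤m , m*g≤d , m≡1⇒b≡1) =
  1≤m , subst (λ g → m * g ≤ d) (gcd-mod b≡b′) m*g≤d , mod-trans (mod-sym b≡b′) ∘ m≡1⇒b≡1

sumFreeAP-mod : ∀ {d a a′ b b′ m k l} → CongMod d a a′ → CongMod d b b′ → ValidAP d a b m →
                SumFree d (InAP d a b m) k l → SumFree d (InAP d a′ b′ m) k l
sumFreeAP-mod {m = m} {k} {l} a≡ b≡ valid sf = ¬collision⇒sumFree
  (validSumFree⇒¬collision valid sf ∘ collision-mod {m = m} {k} {l} (mod-sym a≡) (mod-sym b≡))

sumFreeAPOfSize? : ∀ {d} .{{_ : NonZero d}} k l m → Dec (SumFreeAPOfSize d k l m)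
sumFreeAPOfSize? k l m = ∃-residues?
  (λ {a} {a′} a≡ b≡ (valid , sf) → validAP-mod {a = a} {a′} b≡ valid , sumFreeAP-mod a≡ b≡ valid sf)
  (λ a b → validSumFreeAP? a b m k l)

coprimeSumFreeAPOfSize? : ∀ {c} .{{_ : NonZero c}} k l m → Dec (CoprimeSumFreeAPOfSize c k l m)
coprimeSumFreeAPOfSize? {c} k l m = ∃-residues?
  (λ {a} {a′} {b} {b′} a≡ b≡ (valid , coprime , sf) →
    validAP-mod {a = a} {a′} b≡ valid ,
    trans (gcd-comm b′ c) (trans (sym (gcd-mod b≡)) (trans (gcd-comm c b) coprime)) ,
    sumFreeAP-mod a≡ b≡ valid sf)
  (λ a b → map′ (λ (coprime , valid , sf) → valid , coprime , sf)
                (λ (valid , coprime , sf) → coprime , valid , sf)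
                ((gcd b c ≟ 1) ×-dec validSumFreeAP? a b m k l))

isMaxSize-exists : ∀ {P : ℕ → Set} → (∀ m → Dec (P m)) → ∀ B → (∀ m → P m → m ≤ B) → Σ ℕ (IsMaxSize P)
isMaxSize-exists {P} P? zero bound with P? 0
... | yes p = 0 , inj₁ p , bound
... | no ¬p = 0 , inj₂ (refl , λ m pm → ¬p (subst P (n≤0⇒n≡0 (bound m pm)) pm)) , bound
isMaxSize-exists {P} P? (suc B) bound with P? (suc B)
... | yes p = suc B , inj₁ p , bound
... | no ¬p = isMaxSize-exists P? B λ m pm → s≤s⁻¹ (≤∧≢⇒< (bound m pm) λ { refl → ¬p pm })

alpha-exists : ∀ d .{{_ : NonZero d}} k l → Σ ℕ (IsAlpha d k l)
alpha-exists d k l =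
  isMaxSize-exists (sumFreeAPOfSize? k l) d λ _ (a , _ , valid , _) → validAP⇒≤ {a = a} valid

gamma-exists : ∀ c .{{_ : NonZero c}} k l → Σ ℕ (IsGamma c k l)
gamma-exists c k l =
  isMaxSize-exists (coprimeSumFreeAPOfSize? k l) c λ _ (a , _ , valid , _) → validAP⇒≤ {a = a} valid

-- Reduction to a progression with invertible difference

bezout-mod : ∀ K c .{{_ : NonZero c}} → Σ ℕ λ x → CongMod c (K * x) (gcd K c)
bezout-mod K c@(suc c′) with Bézout.identity (gcd-GCD K c)
... | Bézout.+- x y eq = x , 0 , y , trans (+-identityʳ (K * x)) (trans (*-comm K x) (sym eq))
-- Here x K ≡ − h, and c′ ≡ − 1 (mod c).
... | Bézout.-+ x y eq = x * c′ , h , y * c′ , (begin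
    K * (x * c′) + h * c  ≡⟨ expand K x c′ h ⟩
    h + (h + x * K) * c′  ≡⟨ cong (λ z → h + z * c′) eq ⟩
    h + y * c * c′        ≡⟨ cong (h +_) (swap y c c′) ⟩
    h + y * c′ * c        ∎)
  where
  open ≡-Reasoning
  h = gcd K c
  expand : ∀ K x c′ h → K * (x * c′) + h * suc c′ ≡ h + (h + x * K) * c′
  expand = solve-∀
  swap : ∀ y c c′ → y * c * c′ ≡ y * c′ * c
  swap = solve-∀

nonZero-factorˡ : ∀ {d} .{{_ : NonZero d}} m n → d ≡ m * n → NonZero m
nonZero-factorˡ {d} m n d≡ = ≢-nonZero λ { refl → ≢-nonZero⁻¹ d d≡ }

nonZero-factorʳ : ∀ {d} .{{_ : NonZero d}} m n → d ≡ m * n → NonZero n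
nonZero-factorʳ {d} m n d≡ = ≢-nonZero λ { refl → ≢-nonZero⁻¹ d (trans d≡ (*-zeroʳ m)) }

gcd-quotients-coprime : ∀ {d b c b′} .{{_ : NonZero d}} → d ≡ c * gcd d b → b ≡ b′ * gcd d b → gcd b′ c ≡ 1
gcd-quotients-coprime {d} {b} {c} {b′} d≡ b≡ = *-cancelˡ-≡ (gcd b′ c) 1 g (begin
  g * gcd b′ c         ≡⟨ c*gcd[m,n]≡gcd[cm,cn] g b′ c ⟩
  gcd (g * b′) (g * c) ≡⟨ cong₂ gcd (trans (*-comm g b′) (sym b≡)) (trans (*-comm g c) (sym d≡)) ⟩
  gcd b d              ≡⟨ gcd-comm b d ⟩
  g                    ≡⟨ *-identityʳ g ⟨
  g * 1                ∎)
  where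
  open ≡-Reasoning
  g = gcd d b
  instance _ = gcd-nonZeroˡ d b

validAP-quotient : ∀ {d a a′ b b′ c m} .{{_ : NonZero d}} → d ≡ c * gcd d b → b ≡ b′ * gcd d b →
                   ValidAP d a b m → ValidAP c a′ b′ m
validAP-quotient {d} {b = b} {b′} {c} {m} d≡ b≡ (1≤m , m*g≤d , m≡1⇒b≡1) = 1≤m , m*1≤c , m≡1⇒b′≡1
  where
  g = gcd d b
  instance _ = gcd-nonZeroˡ d b
  m*1≤c : m * gcd c b′ ≤ c
  m*1≤c = subst (λ z → m * z ≤ c) (sym (trans (gcd-comm c b′) (gcd-quotients-coprime {b′ = b′} d≡ b≡)))
                (subst (_≤ c) (sym (*-identityʳ m)) (*-cancelʳ-≤ m c g (subst (m * g ≤_) d≡ m*g≤d)))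
  m≡1⇒b′≡1 : m ≡ 1 → CongMod c b′ 1
  m≡1⇒b′≡1 m≡1 = subst₂ (λ c b′ → CongMod c b′ 1) (by-g≡1 d≡) (by-g≡1 b≡) (m≡1⇒b≡1 m≡1)
    where
    g≡1 : g ≡ 1
    g≡1 = ∣1⇒≡1 (mod-∣ (gcd[m,n]∣m d b) (gcd[m,n]∣n d b) (m≡1⇒b≡1 m≡1))
    by-g≡1 : ∀ {x y} → x ≡ y * g → x ≡ y
    by-g≡1 {y = y} x≡ = trans x≡ (trans (cong (y *_) g≡1) (*-identityʳ y))

coprime-solve : ∀ {c b′} .{{_ : NonZero c}} → gcd b′ c ≡ 1 → ∀ u →
                Σ ℕ λ r → r < c × CongMod c (r * b′) u
coprime-solve {c} {b′} coprime u = (u * x) % c , m%n<n (u * x) c , (begin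
  (u * x) % c * b′ ≈⟨ mod-*ʳ b′ (mod-% (u * x)) ⟨
  u * x * b′       ≡⟨ *-assoc u x b′ ⟩
  u * (x * b′)     ≡⟨ cong (u *_) (*-comm x b′) ⟩
  u * (b′ * x)     ≈⟨ mod-*ˡ u b′*x≡gcd ⟩
  u * gcd b′ c     ≡⟨ cong (u *_) coprime ⟩
  u * 1            ≡⟨ *-identityʳ u ⟩
  u                ∎)
  where
  open ModReasoning c
  x = proj₁ (bezout-mod b′ c)
  b′*x≡gcd = proj₂ (bezout-mod b′ c)

cover : ∀ {c b′ u r S T} → r ≤ c → CongMod c (r * b′) u → c ≤ S + T →
        Σ ℕ λ s → s ≤ S × Σ ℕ λ t → t ≤ T × CongMod c (u + s * b′) (t * b′)
cover {c} {b′} {u} {r} {S} {T} r≤c r*b′≡u c≤S+T with r ≤? T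
... | yes r≤T = 0 , z≤n , r , r≤T , mod-trans (mod-reflexive (+-identityʳ u)) (mod-sym r*b′≡u)
... | no r≰T = c ∸ r , s≤S , 0 , z≤n , (begin
    u + (c ∸ r) * b′      ≈⟨ mod-+ (mod-sym r*b′≡u) mod-refl ⟩
    r * b′ + (c ∸ r) * b′ ≡⟨ *-distribʳ-+ b′ r (c ∸ r) ⟨
    (r + (c ∸ r)) * b′    ≡⟨ cong (_* b′) (m+[n∸m]≡n r≤c) ⟩
    c * b′                ≡⟨ *-comm c b′ ⟩
    b′ * c                ≈⟨ mod-multiple b′ ⟩
    0                     ∎)
  where
  open ModReasoning c
  s≤S : c ∸ r ≤ S
  s≤S = ≤-trans (∸-monoʳ-≤ c (<⇒≤ (≰⇒> r≰T))) (m≤n+o⇒m∸n≤o c T (subst (c ≤_) (+-comm S T) c≤S+T))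

BoundedByCoprimeAP : ℕ → ℕ → ℕ → ℕ → Set
BoundedByCoprimeAP d k l m =
  Σ ℕ λ c → Σ ℕ λ q → d ≡ q * c × Σ ℕ λ m′ → CoprimeSumFreeAPOfSize c k l m′ × m ≤ m′ * q

singleton-coprimeSumFreeAP : ∀ {e l K} .{{_ : NonZero e}} → e ∤ K → CoprimeSumFreeAPOfSize e (l + K) l 1
singleton-coprimeSumFreeAP {e} {l} {K} e∤K =
  1 , 1 , (≤-refl , subst (λ g → 1 * g ≤ e) (sym (gcd-zeroʳ e)) (>-nonZero⁻¹ e) , λ _ → mod-refl) ,
  gcd-zeroˡ e , ¬collision⇒sumFree no-collision
  where
  unit : ∀ n → n * 1 + 0 ≡ n
  unit n = trans (+-identityʳ (n * 1)) (*-identityʳ n)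
  no-collision : ¬ Collision e 1 1 1 (l + K) l
  no-collision (s , s≤ , t , t≤ , coll)
    with refl ← n≤0⇒n≡0 (≤-trans s≤ (≤-reflexive (*-zeroʳ (l + K))))
       | refl ← n≤0⇒n≡0 (≤-trans t≤ (≤-reflexive (*-zeroʳ l))) =
    e∤K (mod-0⇒∣ (mod-+-cancelˡ l
      (subst₂ (CongMod e) (unit (l + K)) (trans (unit l) (sym (+-identityʳ l))) coll)))

boundedByCoprimeAP-singleton : ∀ {d e q l K m} .{{_ : NonZero e}} → d ≡ q * e → e ∤ K → m ≤ q →
                               BoundedByCoprimeAP d (l + K) l m
boundedByCoprimeAP-singleton {e = e} {q} {m = m} d≡ e∤K m≤q =
  e , q , d≡ , 1 , singleton-coprimeSumFreeAP e∤K , subst (m ≤_) (sym (*-identityˡ q)) m≤q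

module _ {d c g a b b′ l K m : ℕ} .{{_ : NonZero c}} .{{_ : NonZero g}} .{{_ : NonZero K}}
         (d≡ : d ≡ g * c) (b≡ : b ≡ b′ * g) (coprime : gcd b′ c ≡ 1)
         (no-collision : ¬ Collision d a b m (l + K) l) where

  lift-mod : ∀ {u} → K * a ≡ u * g → ∀ s t →
             CongMod c (u + s * b′) (t * b′) → CongMod d ((l + K) * a + s * b) (l * a + t * b)
  lift-mod {u} K*a≡ s t reduced = subst (λ d → CongMod d _ _) (sym d≡) (begin
    (l + K) * a + s * b            ≡⟨ regroup l K a s b ⟩
    l * a + (K * a + s * b)        ≡⟨ cong₂ (λ x y → l * a + (x + s * y)) K*a≡ b≡ ⟩
    l * a + (u * g + s * (b′ * g)) ≡⟨ cong (l * a +_) (factor u g s b′) ⟩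
    l * a + g * (u + s * b′)       ≈⟨ mod-+ mod-refl (mod-scale g reduced) ⟩
    l * a + g * (t * b′)           ≡⟨ cong (l * a +_) (*-comm-assoc g t b′) ⟩
    l * a + t * (b′ * g)           ≡⟨ cong (λ y → l * a + t * y) b≡ ⟨
    l * a + t * b                  ∎)
    where
    open ModReasoning (g * c)
    regroup : ∀ l K a s b → (l + K) * a + s * b ≡ l * a + (K * a + s * b)
    regroup = solve-∀
    factor : ∀ u g s b′ → u * g + s * (b′ * g) ≡ g * (u + s * b′)
    factor = solve-∀
    *-comm-assoc : ∀ g t b′ → g * (t * b′) ≡ t * (b′ * g)
    *-comm-assoc = solve-∀

  ≤-cover⇒collision : ∀ {u} → K * a ≡ u * g → c ≤ (l + K) * pred m + l * pred m →
                      Collision d a b m (l + K) l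
  ≤-cover⇒collision {u} K*a≡ c≤ =
    let r , r<c , r*b′≡u = coprime-solve {c} {b′} coprime u
        s , s≤ , t , t≤ , reduced = cover {c} {b′} (<⇒≤ r<c) r*b′≡u c≤
    in s , s≤ , t , t≤ , lift-mod K*a≡ s t reduced

  boundedByCoprimeAP-quotientAP : ∀ {u a′} → K * a ≡ u * g → CongMod c (K * a′) u → ValidAP c a′ b′ m →
                                  BoundedByCoprimeAP d (l + K) l m
  boundedByCoprimeAP-quotientAP {u} {a′} K*a≡ K*a′≡u valid =
    c , g , d≡ , m , (a′ , b′ , valid , coprime , ¬collision⇒sumFree no-collision′) , m≤m*n m g
    where
    regroup : ∀ l K a s b → l * a + (K * a + s * b) ≡ (l + K) * a + s * b
    regroup = solve-∀
    no-collision′ : ¬ Collision c a′ b′ m (l + K) l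
    no-collision′ (s , s≤ , t , t≤ , coll) = no-collision (s , s≤ , t , t≤ , lift-mod K*a≡ s t reduced)
      where
      reduced : CongMod c (u + s * b′) (t * b′)
      reduced = mod-trans (mod-+ (mod-sym K*a′≡u) mod-refl)
                          (mod-+-cancelˡ (l * a′) (mod-trans (mod-reflexive (regroup l K a′ s b′)) coll))

  boundedByCoprimeAP-cover : ∀ {u} → K * a ≡ u * g → gcd K c ∤ u → BoundedByCoprimeAP d (l + K) l m
  boundedByCoprimeAP-cover {u} K*a≡ h∤u with divides c₁ c≡ ← gcd[m,n]∣n K c =
    boundedByCoprimeAP-singleton {e = h * g} d≡c₁*hg hg∤K m≤c₁
    where
    h = gcd K c
    instance
      _ = gcd-nonZeroˡ K c
      _ = m*n≢0 h g
    d≡c₁*hg : d ≡ c₁ * (h * g)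
    d≡c₁*hg = trans d≡ (trans (*-comm g c) (trans (cong (_* g) c≡) (*-assoc c₁ h g)))
    hg∤K : h * g ∤ K
    hg∤K (divides r K≡) = h∤u (divides (r * a) (*-cancelʳ-≡ u (r * a * h) g
      (trans (sym K*a≡) (trans (cong (_* a) K≡) (regroup r h g a)))))
      where
      regroup : ∀ r h g a → r * (h * g) * a ≡ r * a * h * g
      regroup = solve-∀
    m≤c₁ : m ≤ c₁
    m≤c₁ with m ≤? c₁
    ... | yes m≤c₁ = m≤c₁
    ... | no m≰c₁ = contradiction (≤-cover⇒collision {u} K*a≡ c≤) no-collision
      where
      c≤ : c ≤ (l + K) * pred m + l * pred m
      c≤ = begin
        c                             ≡⟨ c≡ ⟩
        c₁ * h                        ≤⟨ *-mono-≤ (<⇒≤pred (≰⇒> m≰c₁)) (∣⇒≤ (gcd[m,n]∣m K c)) ⟩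
        pred m * K                    ≤⟨ *-monoʳ-≤ (pred m) (m≤n+m K l) ⟩
        pred m * (l + K)              ≡⟨ *-comm (pred m) (l + K) ⟩
        (l + K) * pred m              ≤⟨ m≤m+n ((l + K) * pred m) (l * pred m) ⟩
        (l + K) * pred m + l * pred m ∎
        where open ≤-Reasoning

  boundedByCoprimeAP-quotients : (∀ {a′} → ValidAP c a′ b′ m) → BoundedByCoprimeAP d (l + K) l m
  boundedByCoprimeAP-quotients valid with g ∣? K * a
  ... | no g∤Ka =
    boundedByCoprimeAP-singleton (trans d≡ (*-comm g c)) (g∤Ka ∘ ∣m⇒∣m*n a)
                                 (validAP⇒≤ {a = 0} {b′} (valid {0}))
  ... | yes (divides u K*a≡) with gcd K c ∣? u
  ...   | no h∤u = boundedByCoprimeAP-cover {u} K*a≡ h∤u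
  ...   | yes (divides w u≡) = boundedByCoprimeAP-quotientAP {u} K*a≡ K*xw≡u (valid {x * w})
    where
    open ModReasoning c
    x = proj₁ (bezout-mod K c)
    K*xw≡u : CongMod c (K * (x * w)) u
    K*xw≡u = begin
      K * (x * w)   ≡⟨ *-assoc K x w ⟨
      K * x * w     ≈⟨ mod-*ʳ w (proj₂ (bezout-mod K c)) ⟩
      gcd K c * w   ≡⟨ *-comm (gcd K c) w ⟩
      w * gcd K c   ≡⟨ u≡ ⟨
      u             ∎

sumFreeAP⇒boundedByCoprimeAP : ∀ {d a b m l K} .{{_ : NonZero d}} .{{_ : NonZero K}} →
  ValidAP d a b m → SumFree d (InAP d a b m) (l + K) l → BoundedByCoprimeAP d (l + K) l m
sumFreeAP⇒boundedByCoprimeAP {d} {a} {b} valid sumFree =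
  boundedByCoprimeAP-quotients (trans d≡ (*-comm c (gcd d b))) b≡
    (gcd-quotients-coprime {c = c} {b′} d≡ b≡) (validSumFree⇒¬collision valid sumFree)
    (λ {a′} → validAP-quotient {a = a} {a′} {b′ = b′} {c} d≡ b≡ valid)
  where
  open _∣_ (gcd[m,n]∣m d b) renaming (quotient to c; equality to d≡)
  open _∣_ (gcd[m,n]∣n d b) renaming (quotient to b′; equality to b≡)
  instance
    _ = gcd-nonZeroˡ d b
    _ = nonZero-factorˡ c (gcd d b) d≡

alpha≤gamma*quotient : ∀ d l K .{{_ : NonZero d}} .{{_ : NonZero K}} →
  Σ ℕ λ c → Σ ℕ λ q → d ≡ q * c ×
    Σ ℕ λ α → Σ ℕ λ γ → IsAlpha d (l + K) l α × IsGamma c (l + K) l γ × α ≤ γ * q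
alpha≤gamma*quotient d l K with alpha-exists d (l + K) l
... | α , isα@(inj₂ (refl , _) , _) =
  let γ , isγ = gamma-exists d (l + K) l in d , 1 , sym (*-identityˡ d) , 0 , γ , isα , isγ , z≤n
... | α , isα@(inj₁ (a , b , valid , sumFree) , _) =
  let c , q , d≡ , m′ , coprimeAP , α≤m′*q = sumFreeAP⇒boundedByCoprimeAP {a = a} valid sumFree
      instance _ = nonZero-factorʳ q c d≡
      γ , isγ@(_ , maximal) = gamma-exists c (l + K) l
  in c , q , d≡ , α , γ , isα , isγ , ≤-trans α≤m′*q (*-monoˡ-≤ q (maximal m′ coprimeAP))

theorem12 : (d k l : ℕ) → 0 < d → 0 < l → l < k →
    Σ ℕ λ c → Σ ℕ λ q → d ≡ q * c ×
      Σ ℕ λ α → Σ ℕ λ γ → IsAlpha d k l α × IsGamma c k l γ × α ≤ γ * q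
theorem12 d k l 0<d _ l<k with k ∸ l | m+[n∸m]≡n (<⇒≤ l<k) | m<n⇒0<n∸m l<k
... | K | refl | 0<K = alpha≤gamma*quotient d l K {{>-nonZero 0<d}} {{>-nonZero 0<K}}
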